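{- In a proof of $\mathrm{L}_\odot$, for every $k$-extended-redex $S_0,\dots,S_k$, either all the rules concluding $S_0,\dots,S_{k-1}$ are $\odot_e$ rules, or the $k$-extended-redex contains (as a sub-path) a $k'$-extended-redex with $k'<k$.
   Context: The Lambek calculus with product $\mathrm{L}_\odot$ (natural deduction, sequent style). Formulas are built from propositional variables with $\backslash$, $/$, $\odot$; sequents are $\Gamma\vdash C$ with $\Gamma$ a finite sequence. Rules: axiom $A\vdash A$; $\backslash_e$: from $\Gamma\vdash A$ and $\Delta\vdash A\backslash C$ infer $\Gamma,\Delta\vdash C$; $/_e$: from $\Delta\vdash C/A$ and $\Gamma\vdash A$ infer $\Delta,\Gamma\vdash C$; $\backslash_i$: from $A,\Gamma\vdash C$ infer $\Gamma\vdash A\backslash C$; $/_i$: from $\Gamma,A\vdash C$ infer $\Gamma\vdash C/A$; $\odot_i$: from $\Delta\vdash A$, $\Gamma\vdash B$ infer $\Delta,\Gamma\vdash A\odot B$; $\odot_e$: from $\Delta\vdash A\odot B$ and $\Gamma,A,B,\Gamma'\vdash C$ infer $\Gamma,\Delta,\Gamma'\vdash C$. Principal branch $B(S_0)$ of a sequent occurrence $S_0$: the smallest set containing $S_0$ such that for $S\in B(S_0)$: if $S$ is concluded by a unary rule its premise is in it; if by $\odot_e$, the premise $\Gamma,A,B,\Gamma'\vdash C$ is in it; if by an implication elimination, the premise carrying the implication is in it. A $k$-extended-redex: for an elimination rule with major premise $S_0$ (the premise whose right-hand formula has the eliminated connective as main connective), a path $S_0,S_1,\dots,S_k$ in $B(S_0)$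 (each $S_{i+1}$ the premise in $B(S_0)$ of the rule concluding $S_i$) such that $S_k$ is the conclusion of an introduction rule and $S_0$ and $S_k$ have the same right-hand formula. $0$-extended-redexes are the usual redexes (introduction immediately followed by the elimination of the same connective). -}

module Defs where

open import Data.Nat using (ℕ; zero; suc)
open import Data.List using (List; []; _∷_; _++_; [_])
open import Data.Maybe using (Maybe; just; nothing)
open import Relation.Binary.PropositionalEquality using (_≡_)

-- Formulas of L⊙ : variables, A \ C  (ldiv A C),  C / A  (rdiv C A),  A ⊙ B

data Fm : Set where
  var  : ℕ → Fm
  ldiv : Fm → Fm → Fm
  rdiv : Fm → Fm → Fm
  _⊙_  : Fm → Fm → Fm

infix 4 _⊢_

data _⊢_ : List Fm → Fm → Set where
  ax  : ∀ {A} → [ A ] ⊢ A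
  ldivE  : ∀ {Γ Δ A C} → Γ ⊢ A → Δ ⊢ ldiv A C → Γ ++ Δ ⊢ C
  rdivE : ∀ {Γ Δ A C} → Δ ⊢ rdiv C A → Γ ⊢ A → Δ ++ Γ ⊢ C
  ldivI  : ∀ {Γ A C} → A ∷ Γ ⊢ C → Γ ⊢ ldiv A C
  rdivI : ∀ {Γ A C} → Γ ++ [ A ] ⊢ C → Γ ⊢ rdiv C A
  ⊙i  : ∀ {Γ Δ A B} → Δ ⊢ A → Γ ⊢ B → Δ ++ Γ ⊢ A ⊙ B
  ⊙e  : ∀ {Γ Γ' Δ A B C} → Δ ⊢ A ⊙ B → Γ ++ A ∷ B ∷ Γ' ⊢ C → Γ ++ Δ ++ Γ' ⊢ C

-- A derivation packaged with its end sequent (a "sequent occurrence" together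
-- with the subproof above it).
record Der : Set where
  constructor der
  field
    ant   : List Fm
    rhs   : Fm
    proof : ant ⊢ rhs
open Der public

data _⊑_ : Der → Der → Set where
  here   : ∀ {π} → π ⊑ π
  ldivE-l   : ∀ {e Γ Δ A C} {p : Γ ⊢ A} {q : Δ ⊢ ldiv A C} → e ⊑ der _ _ p → e ⊑ der _ _ (ldivE p q)
  ldivE-r   : ∀ {e Γ Δ A C} {p : Γ ⊢ A} {q : Δ ⊢ ldiv A C} → e ⊑ der _ _ q → e ⊑ der _ _ (ldivE p q)
  rdivE-l   : ∀ {e Γ Δ A C} {q : Δ ⊢ rdiv C A} {p : Γ ⊢ A} → e ⊑ der _ _ q → e ⊑ der _ _ (rdivE q p)
  rdivE-r   : ∀ {e Γ Δ A C} {q : Δ ⊢ rdiv C A} {p : Γ ⊢ A} → e ⊑ der _ _ p → e ⊑ der _ _ (rdivE q p)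
  ldivI-1   : ∀ {e Γ A C} {p : A ∷ Γ ⊢ C} → e ⊑ der _ _ p → e ⊑ der _ _ (ldivI p)
  rdivI-1   : ∀ {e Γ A C} {p : Γ ++ [ A ] ⊢ C} → e ⊑ der _ _ p → e ⊑ der _ _ (rdivI p)
  ⊙i-l   : ∀ {e Γ Δ A B} {p : Δ ⊢ A} {q : Γ ⊢ B} → e ⊑ der _ _ p → e ⊑ der _ _ (⊙i p q)
  ⊙i-r   : ∀ {e Γ Δ A B} {p : Δ ⊢ A} {q : Γ ⊢ B} → e ⊑ der _ _ q → e ⊑ der _ _ (⊙i p q)
  ⊙e-l   : ∀ {e Γ Γ' Δ A B C} {p : Δ ⊢ A ⊙ B} {q : Γ ++ A ∷ B ∷ Γ' ⊢ C} →
           e ⊑ der _ _ p → e ⊑ der _ _ (⊙e {Γ} {Γ'} p q)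
  ⊙e-r   : ∀ {e Γ Γ' Δ A B C} {p : Δ ⊢ A ⊙ B} {q : Γ ++ A ∷ B ∷ Γ' ⊢ C} →
           e ⊑ der _ _ q → e ⊑ der _ _ (⊙e {Γ} {Γ'} p q)

-- The premise in the principal branch of the rule concluding a sequent
-- (as in the definition of B(S0)): unary rules (ldivI, rdivI): their premise;
-- ⊙e: the premise Γ,A,B,Γ' ⊢ C; implication eliminations: the premise carrying
-- the implication; axiom and ⊙i (binary, not an elimination): none.
principal : Der → Maybe Der
principal (der _ _ ax)        = nothing
principal (der _ _ (ldivE p q))  = just (der _ _ q)
principal (der _ _ (rdivE q p))  = just (der _ _ q)
principal (der _ _ (ldivI p))    = just (der _ _ p)
principal (der _ _ (rdivI p))    = just (der _ _ p)
principal (der _ _ (⊙i p q))  = nothing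
principal (der _ _ (⊙e p q))  = just (der _ _ q)

-- branch S₀ i = S_i : the i-th sequent of the path S₀,S₁,… in B(S₀)
-- (nothing if the path stops before i).
branch : Der → ℕ → Maybe Der
branch d zero    = just d
branch d (suc n) with principal d
... | nothing = nothing
... | just e  = branch e n

data IsIntro : Der → Set where
  ldivI-intro : ∀ {Γ A C} {p : A ∷ Γ ⊢ C} → IsIntro (der _ _ (ldivI p))
  rdivI-intro : ∀ {Γ A C} {p : Γ ++ [ A ] ⊢ C} → IsIntro (der _ _ (rdivI p))
  ⊙i-intro : ∀ {Γ Δ A B} {p : Δ ⊢ A} {q : Γ ⊢ B} → IsIntro (der _ _ (⊙i p q))

data IsOdotE : Der → Set where
  ⊙e-rule : ∀ {Γ Γ' Δ A B C} {p : Δ ⊢ A ⊙ B} {q : Γ ++ A ∷ B ∷ Γ' ⊢ C} →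
            IsOdotE (der _ _ (⊙e {Γ} {Γ'} p q))

data MajorOf : Der → Der → Set where
  ldivE-major : ∀ {Γ Δ A C} {p : Γ ⊢ A} {q : Δ ⊢ ldiv A C} → MajorOf (der _ _ (ldivE p q)) (der _ _ q)
  rdivE-major : ∀ {Γ Δ A C} {q : Δ ⊢ rdiv C A} {p : Γ ⊢ A} → MajorOf (der _ _ (rdivE q p)) (der _ _ q)
  ⊙e-major : ∀ {Γ Γ' Δ A B C} {p : Δ ⊢ A ⊙ B} {q : Γ ++ A ∷ B ∷ Γ' ⊢ C} →
             MajorOf (der _ _ (⊙e {Γ} {Γ'} p q)) (der _ _ p)

record MajorIn (π : Der) (m : Der) : Set where
  constructor majorIn
  field
    elim   : Der
    occ    : elim ⊑ π
    major  : MajorOf elim m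

-- S_i (in the path starting at S₀) is the major premise of an elimination rule:
-- for i = 0 this is the given elimination of the extended redex; for i = j+1,
-- S_i is the premise of the rule concluding S_j, and it is the major premise of
-- an elimination exactly when that rule is an elimination having S_i as major
-- premise.
data MajorAt (S₀ : Der) : ℕ → Set where
  major-zero : MajorAt S₀ zero
  major-suc  : ∀ {j Sj Si} → branch S₀ j ≡ just Sj → principal Sj ≡ just Si →
               MajorOf Sj Si → MajorAt S₀ (suc j)

-- The path S_i,…,S_j (i ≤ j) of B(S₀) ends at an introduction whose right-hand
-- formula is that of S_i, i.e. (together with MajorAt) it is a (j-i)-extended-redex.
record EndsInIntroSameRhs (S₀ : Der) (i j : ℕ) : Set where
  constructor endsIn
  field
    Si     : Der
    Sj     : Der
    eqi    : branch S₀ i ≡ just Si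
    eqj    : branch S₀ j ≡ just Sj
    intro  : IsIntro Sj
    samerhs : rhs Si ≡ rhs Sj

-- Along the principal branch, ⊙e keeps the right-hand formula while every other
-- rule changes it.  Walking the path S₀,…,S_k from the top: if some S_i (i < k)
-- is concluded by an introduction with S₀,…,S_{i-1} all concluded by ⊙e, then
-- S₀,…,S_i is already an i-extended-redex; if S_i is concluded by an implication
-- elimination, then S_{i+1} is a major premise and the rest of the path, which
-- still ends in an introduction, is handled by induction (if it consists of ⊙e
-- rules only, S_{i+1},…,S_k is itself a shorter extended redex).
module Submission where

open import Defs
open import Data.Nat using (ℕ; zero; suc; _<_; _≤_; _∸_; z≤n; s≤s)
open import Data.Nat.Properties using (≤-refl; n<1+n; m≤n⇒m≤1+n)
open import Data.Maybe using (just)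
open import Data.Product using (Σ; _×_; _,_)
open import Data.Sum using (_⊎_; inj₁; inj₂)
open import Relation.Binary.PropositionalEquality using (_≡_; refl; trans)

AllOdotE : Der → ℕ → Set
AllOdotE S₀ k = ∀ (i : ℕ) → i < k → ∀ (Si : Der) → branch S₀ i ≡ just Si → IsOdotE Si

ShorterRedex : Der → ℕ → Set
ShorterRedex S₀ k =
  Σ ℕ (λ i → Σ ℕ (λ j → i ≤ j × j ≤ k × j ∸ i < k × MajorAt S₀ i × EndsInIntroSameRhs S₀ i j))

OdotEPathOrShorterRedex : Der → ℕ → Der → Set
OdotEPathOrShorterRedex S₀ n Sn = (AllOdotE S₀ n × rhs S₀ ≡ rhs Sn) ⊎ ShorterRedex S₀ n

branch-principal : ∀ {d e} → principal d ≡ just e → (n : ℕ) → branch d (suc n) ≡ branch e n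
branch-principal {d} d→e n with principal d
branch-principal {d} refl n | just _ = refl

module _ {d e : Der} (d→e : principal d ≡ just e) where

  majorAt-principal : ∀ {i} → MajorAt e (suc i) → MajorAt d (suc (suc i))
  majorAt-principal (major-suc {j} bj pj mj) = major-suc (trans (branch-principal d→e j) bj) pj mj

  endsIn-principal : ∀ {i j} → EndsInIntroSameRhs e i j → EndsInIntroSameRhs d (suc i) (suc j)
  endsIn-principal {i} {j} (endsIn Si Sj ei ej intro same) =
    endsIn Si Sj (trans (branch-principal d→e i) ei) (trans (branch-principal d→e j) ej) intro same

  -- After an elimination with major premise e the redex is shifted by one; after
  -- a rule preserving the right-hand formula a redex starting at e is prolonged to d.
  shorterRedex-principal : ∀ {n} → MajorOf d e ⊎ rhs d ≡ rhs e →
    ShorterRedex e n → ShorterRedex d (suc n)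
  shorterRedex-principal (inj₁ major) (zero , j , _ , j≤n , j<n , _ , ends) =
    1 , suc j , s≤s z≤n , s≤s j≤n , m≤n⇒m≤1+n j<n , major-suc refl d→e major , endsIn-principal ends
  shorterRedex-principal (inj₂ same) (zero , j , _ , j≤n , j<n , _ , endsIn _ Sj refl ej intro same′) =
    0 , suc j , z≤n , s≤s j≤n , s≤s j<n , major-zero ,
    endsIn d Sj refl (trans (branch-principal d→e j) ej) intro (trans same same′)
  shorterRedex-principal _ (suc i , suc j , s≤s i≤j , j≤n , j∸i<n , majorAt , ends) =
    suc (suc i) , suc (suc j) , s≤s (s≤s i≤j) , s≤s j≤n , m≤n⇒m≤1+n j∸i<n ,
    majorAt-principal majorAt , endsIn-principal ends

  shorterRedex-after-major : ∀ {n Sn} → MajorOf d e → branch e n ≡ just Sn → IsIntro Sn →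
    OdotEPathOrShorterRedex e n Sn → ShorterRedex d (suc n)
  shorterRedex-after-major {n} major en intro (inj₁ (_ , same)) =
    1 , suc n , s≤s z≤n , ≤-refl , n<1+n n , major-suc refl d→e major ,
    endsIn e _ (branch-principal d→e 0) (trans (branch-principal d→e n) en) intro same
  shorterRedex-after-major major _ _ (inj₂ redex) = shorterRedex-principal (inj₁ major) redex

odotE-path-or-shorterRedex : (S₀ : Der) (n : ℕ) {Sn : Der} → branch S₀ n ≡ just Sn → IsIntro Sn →
  OdotEPathOrShorterRedex S₀ n Sn
odotE-path-or-shorterRedex S₀ zero refl _ = inj₁ ((λ _ ()) , refl)
odotE-path-or-shorterRedex (der _ _ (ldivI p)) (suc n) _ _ =
  inj₂ (0 , 0 , z≤n , z≤n , s≤s z≤n , major-zero , endsIn _ _ refl refl ldivI-intro refl)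
odotE-path-or-shorterRedex (der _ _ (rdivI p)) (suc n) _ _ =
  inj₂ (0 , 0 , z≤n , z≤n , s≤s z≤n , major-zero , endsIn _ _ refl refl rdivI-intro refl)
odotE-path-or-shorterRedex (der _ _ (ldivE p q)) (suc n) en intro =
  inj₂ (shorterRedex-after-major refl ldivE-major en intro
         (odotE-path-or-shorterRedex (der _ _ q) n en intro))
odotE-path-or-shorterRedex (der _ _ (rdivE q p)) (suc n) en intro =
  inj₂ (shorterRedex-after-major refl rdivE-major en intro
         (odotE-path-or-shorterRedex (der _ _ q) n en intro))
odotE-path-or-shorterRedex (der _ _ (⊙e p q)) (suc n) en intro
  with odotE-path-or-shorterRedex (der _ _ q) n en intro
... | inj₁ (allOdotE , same) = inj₁ (allOdotE′ , same)
  where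
  allOdotE′ : AllOdotE (der _ _ (⊙e p q)) (suc n)
  allOdotE′ zero    _         _  refl = ⊙e-rule
  allOdotE′ (suc i) (s≤s i<n) Si bi   = allOdotE i i<n Si bi
... | inj₂ redex = inj₂ (shorterRedex-principal refl (inj₂ refl) redex)

mainTheorem7 : (π S₀ : Der) → MajorIn π S₀ → (k : ℕ) →
    EndsInIntroSameRhs S₀ 0 k →
    (∀ (i : ℕ) → i < k → ∀ (Si : Der) → branch S₀ i ≡ just Si → IsOdotE Si)
    ⊎ Σ ℕ (λ i → Σ ℕ (λ j → i ≤ j × j ≤ k × j ∸ i < k × MajorAt S₀ i × EndsInIntroSameRhs S₀ i j))
mainTheorem7 _ S₀ _ k (endsIn _ _ _ ek intro _) with odotE-path-or-shorterRedex S₀ k ek intro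
... | inj₁ (allOdotE , _) = inj₁ allOdotE
... | inj₂ redex          = inj₂ redex
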